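{- Let $G$ be a connected graph such that its complement $G^c$ is connected. Then every strong resolving cover of $G$ is a simultaneous strong metric generator for $\{G,G^c\}$, i.e., it is a strong metric generator both for $G$ and for $G^c$.
   Context: All graphs are finite, simple and undirected; $G^c$ denotes the complement of $G$ on the same vertex set. For a connected graph $H$, $d_H(x,y)$ is the length of a shortest $x$–$y$ path. A vertex $w$ strongly resolves two vertices $u,v$ of $H$ if $d_H(u,w)=d_H(u,v)+d_H(v,w)$ or $d_H(v,w)=d_H(v,u)+d_H(u,w)$. A set $S\subseteq V(H)$ is a strong metric generator for $H$ if every two distinct vertices of $H$ are strongly resolved by some vertex of $S$. A vertex cover of $G$ is a set of vertices incident with every edge of $G$. A strong resolving cover for $G$ is a set $S\subseteq V(G)$ that is both a vertex cover of $G$ and a strong metric generator for $G$. -}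

module Defs where

open import Data.Nat using (ℕ; zero; suc; _+_; _<_)
open import Data.Fin using (Fin)
open import Data.Product using (Σ; ∃; _×_; _,_)
open import Data.Sum using (_⊎_)
open import Relation.Nullary using (¬_)
open import Relation.Binary.PropositionalEquality using (_≡_; _≢_)

record Graph (n : ℕ) : Set₁ where
  field
    Adj   : Fin n → Fin n → Set
    sym   : ∀ {u v} → Adj u v → Adj v u
    irrefl : ∀ {u} → ¬ Adj u u
open Graph public

complement : ∀ {n} → Graph n → Graph n
complement G = record
  { Adj    = λ u v → (u ≢ v) × ¬ Adj G u v
  ; sym    = λ { (u≢v , ¬a) → (λ e → u≢v (sym≡ e)) , (λ a → ¬a (sym G a)) }
  ; irrefl = λ { (u≢u , _) → u≢u _≡_.refl }
  }
  where
  sym≡ : ∀ {A : Set} {x y : A} → x ≡ y → y ≡ x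
  sym≡ _≡_.refl = _≡_.refl

data Walk {n : ℕ} (G : Graph n) : Fin n → Fin n → ℕ → Set where
  here : ∀ {u} → Walk G u u zero
  step : ∀ {u v w k} → Adj G u v → Walk G v w k → Walk G u w (suc k)

Connected : ∀ {n} → Graph n → Set
Connected G = ∀ u v → ∃ λ k → Walk G u v k

Dist : ∀ {n} → Graph n → Fin n → Fin n → ℕ → Set
Dist G u v k = Walk G u v k × (∀ j → j < k → ¬ Walk G u v j)

StronglyResolves : ∀ {n} → Graph n → Fin n → Fin n → Fin n → Set
StronglyResolves G w u v =
    (∃ λ a → ∃ λ b → ∃ λ c →
       Dist G u w a × Dist G u v b × Dist G v w c × a ≡ b + c)
  ⊎ (∃ λ a → ∃ λ b → ∃ λ c →
       Dist G v w a × Dist G v u b × Dist G u w c × a ≡ b + c)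

StrongMetricGenerator : ∀ {n} → Graph n → (Fin n → Set) → Set
StrongMetricGenerator G S =
  ∀ u v → u ≢ v → ∃ λ w → S w × StronglyResolves G w u v

VertexCover : ∀ {n} → Graph n → (Fin n → Set) → Set
VertexCover G S = ∀ u v → Adj G u v → S u ⊎ S v

StrongResolvingCover : ∀ {n} → Graph n → (Fin n → Set) → Set
StrongResolvingCover G S = VertexCover G S × StrongMetricGenerator G S

module Submission where

open import Defs
open import Data.Nat using (ℕ; zero; suc; _+_; _≤_; _<_; s≤s; z≤n)
open import Data.Nat.Properties using (n<1+n; m<1+n⇒m<n∨m≡n; ≮⇒≥; m+n≮n; +-identityʳ)
open import Data.Fin using (Fin; _≟_)
open import Data.Fin.Properties using (any?)
open import Data.Product using (_×_; _,_; ∃; proj₂; map₂)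
open import Data.Sum using (_⊎_; inj₁; inj₂; [_,_]; swap)
open import Data.Empty using (⊥-elim)
open import Function using (_∘_)
open import Relation.Nullary using (¬_; Dec; yes; no)
open import Relation.Nullary.Decidable using (_×-dec_; ¬?; map′)
open import Relation.Binary.Definitions using (Decidable)
open import Relation.Binary.PropositionalEquality as ≡ using (_≡_; _≢_; refl; ≢-sym)

-- A pair u, v adjacent in G has an endpoint in the cover S, and an endpoint
-- resolves its own pair in any graph. If u, v are not adjacent in G, some w ∈ S
-- has v on a shortest u–w path of G; let y follow v on it. The cover puts v or y
-- into S. As v lies on a geodesic to w, y is not adjacent to u in G, so in the
-- complement u is adjacent to v and to y while v, y are not adjacent:
-- there d(v,y) = 2 = d(v,u) + d(u,y). Distances in the complement exist
-- constructively because adjacency in G is decidable, as witnessed by the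
-- G-distances that the generator provides.

module _ {P : ℕ → Set} (P? : ∀ k → Dec (P k)) where

  least-below : ∀ k → (∃ λ m → P m × (∀ j → j < m → ¬ P j)) ⊎ (∀ j → j < k → ¬ P j)
  least-below zero = inj₂ λ _ ()
  least-below (suc k) with least-below k
  ... | inj₁ found = inj₁ found
  ... | inj₂ none with P? k
  ...   | yes pk = inj₁ (k , pk , none)
  ...   | no ¬pk = inj₂ λ j j<1+k → [ none j , (λ { refl → ¬pk }) ] (m<1+n⇒m<n∨m≡n j<1+k)

  least-witness : ∀ {k} → P k → ∃ λ m → P m × (∀ j → j < m → ¬ P j)
  least-witness {k} pk with least-below (suc k)
  ... | inj₁ found = found
  ... | inj₂ none = ⊥-elim (none k (n<1+n k) pk)

module _ {n : ℕ} (G : Graph n) where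

  Adj⇒≢ : ∀ {u v} → Adj G u v → u ≢ v
  Adj⇒≢ uv refl = irrefl G uv

  walk? : Decidable (Adj G) → ∀ k u v → Dec (Walk G u v k)
  walk? adj? zero u v with u ≟ v
  ... | yes refl = yes here
  ... | no u≢v = no λ { here → u≢v refl }
  walk? adj? (suc k) u v with any? (λ x → adj? u x ×-dec walk? adj? k x v)
  ... | yes (_ , ux , xv) = yes (step ux xv)
  ... | no ∄ = no λ { (step ux xv) → ∄ (_ , ux , xv) }

  Connected⇒Dist : Decidable (Adj G) → Connected G → ∀ u v → ∃ (Dist G u v)
  Connected⇒Dist adj? conn u v = least-witness (λ k → walk? adj? k u v) (proj₂ (conn u v))

  Dist-≤-Walk : ∀ {u v a k} → Dist G u v a → Walk G u v k → a ≤ k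
  Dist-≤-Walk (_ , shortest) w = ≮⇒≥ λ k<a → shortest _ k<a w

  dist-0 : ∀ {u} → Dist G u u 0
  dist-0 = here , λ _ ()

  dist-1 : ∀ {u v} → Adj G u v → Dist G u v 1
  dist-1 uv = step uv here , λ
    { zero _ here → irrefl G uv
    ; (suc _) (s≤s ()) _
    }

  dist-2 : ∀ {u v w} → Adj G u v → Adj G v w → u ≢ w → ¬ Adj G u w → Dist G u w 2
  dist-2 uv vw u≢w ¬uw = step uv (step vw here) , λ
    { zero _ here → u≢w refl
    ; (suc zero) _ (step uw here) → ¬uw uw
    ; (suc (suc _)) (s≤s (s≤s ())) _
    }

  Dist⇒Adj? : ∀ {u v k} → u ≢ v → Dist G u v k → Dec (Adj G u v)
  Dist⇒Adj? u≢v (here , _) = ⊥-elim (u≢v refl)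
  Dist⇒Adj? u≢v (step uv here , _) = yes uv
  Dist⇒Adj? u≢v (step _ (step _ _) , shortest) =
    no λ uv → shortest 1 (s≤s (s≤s z≤n)) (step uv here)

  complement-Adj? : Decidable (Adj G) → Decidable (Adj (complement G))
  complement-Adj? adj? u v = ¬? (u ≟ v) ×-dec ¬? (adj? u v)

-- StronglyResolves G w u v unfolds to OnGeodesic G u v w ⊎ OnGeodesic G v u w.
OnGeodesic : ∀ {n} → Graph n → Fin n → Fin n → Fin n → Set
OnGeodesic G u v w = ∃ λ a → ∃ λ b → ∃ λ c →
  Dist G u w a × Dist G u v b × Dist G v w c × a ≡ b + c

module _ {n : ℕ} {G : Graph n} where

  StronglyResolves-sym : ∀ {w u v} → StronglyResolves G w u v → StronglyResolves G w v u
  StronglyResolves-sym = swap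

  endpoint-resolves : ∀ {u v k} → Dist G u v k → StronglyResolves G v u v
  endpoint-resolves {k = k} duv = inj₁ (k , k , 0 , duv , duv , dist-0 G , ≡.sym (+-identityʳ k))

module _ {n : ℕ} {G : Graph n} where

  StrongMetricGenerator⇒Adj? : ∀ {S} → StrongMetricGenerator G S → Decidable (Adj G)
  StrongMetricGenerator⇒Adj? smg u v with u ≟ v
  ... | yes refl = no (irrefl G)
  ... | no u≢v with smg u v u≢v
  ...   | _ , _ , inj₁ (_ , _ , _ , _ , duv , _) = Dist⇒Adj? G u≢v duv
  ...   | _ , _ , inj₂ (_ , _ , _ , _ , dvu , _) =
    map′ (sym G) (sym G) (Dist⇒Adj? G (≢-sym u≢v) dvu)

  resolves-in-complement : ∀ {u v y} → ¬ Adj G u v → Adj G v y → ¬ Adj G u y →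
    u ≢ v → StronglyResolves (complement G) y u v
  resolves-in-complement ¬uv vy ¬uy u≢v =
    inj₂ (2 , 1 , 1 , dist-2 Gᶜ vu uy (Adj⇒≢ G vy) (λ vyᶜ → proj₂ vyᶜ vy)
            , dist-1 Gᶜ vu , dist-1 Gᶜ uy , refl)
    where
    Gᶜ = complement G
    vu : Adj Gᶜ _ _
    vu = ≢-sym u≢v , ¬uv ∘ sym G
    uy : Adj Gᶜ _ _
    uy = (λ { refl → ¬uv (sym G vy) }) , ¬uy

  geodesic-resolver-in-complement : ∀ {S u v w} → VertexCover G S → u ≢ v → ¬ Adj G u v →
    OnGeodesic G u v w → S w → ∃ λ w′ → S w′ × StronglyResolves (complement G) w′ u v
  geodesic-resolver-in-complement _ u≢v _ (_ , _ , _ , _ , (here , _) , _ , _) _ = ⊥-elim (u≢v refl)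
  geodesic-resolver-in-complement _ u≢v ¬uv (_ , _ , _ , _ , _ , (here , _) , _) sv =
    _ , sv , endpoint-resolves (dist-1 (complement G) (u≢v , ¬uv))
  geodesic-resolver-in-complement {u = u} {v} cover u≢v ¬uv
    (a , suc b , suc c , duw , _ , (step {v = y} vy yw , _) , a≡b+1+c) sw with cover v y vy
  ... | inj₁ sv = v , sv , endpoint-resolves (dist-1 (complement G) (u≢v , ¬uv))
  ... | inj₂ sy = y , sy , resolves-in-complement ¬uv vy ¬uy u≢v
    where
    ¬uy : ¬ Adj G u y
    ¬uy uy = m+n≮n b (suc c) (≡.subst (_≤ suc c) a≡b+1+c (Dist-≤-Walk G duw (step uy yw)))

mainTheorem6 : ∀ {n : ℕ} (G : Graph n) (S : Fin n → Set) →
    Connected G → Connected (complement G) →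
    StrongResolvingCover G S →
    StrongMetricGenerator G S × StrongMetricGenerator (complement G) S
mainTheorem6 G S _ connᶜ (cover , smg) = smg , smgᶜ
  where
  distᶜ : ∀ u v → ∃ (Dist (complement G) u v)
  distᶜ = Connected⇒Dist (complement G)
            (complement-Adj? G (StrongMetricGenerator⇒Adj? smg)) connᶜ

  smgᶜ : StrongMetricGenerator (complement G) S
  smgᶜ u v u≢v with StrongMetricGenerator⇒Adj? smg u v
  ... | yes uv =
    [ (λ su → u , su , StronglyResolves-sym (endpoint-resolves (proj₂ (distᶜ v u))))
    , (λ sv → v , sv , endpoint-resolves (proj₂ (distᶜ u v)))
    ] (cover u v uv)
  ... | no ¬uv with smg u v u≢v
  ...   | _ , sw , inj₁ uvw = geodesic-resolver-in-complement cover u≢v ¬uv uvw sw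
  ...   | _ , sw , inj₂ vuw = map₂ (map₂ StronglyResolves-sym)
    (geodesic-resolver-in-complement cover (≢-sym u≢v) (¬uv ∘ sym G) vuw sw)
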